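{- Let $n,d,k$ be positive integers. Then $$\sum_{\lambda\in\mathcal{C}_{n,dn+1}}|\lambda|^k=\sum_{I\in\mathcal{B}^+_{d,n-1}}\Bigl(\sum_{(i,j)\in I}\bigl((i-1)n+j\bigr)-\frac{|I|^2}{2}+\frac{|I|}{2}\Bigr)^k.$$
   Context: A partition $\lambda=(\lambda_1\ge\dots\ge\lambda_\ell)$ has size $|\lambda|=\sum_i\lambda_i$. The hook length of a box of its Young diagram is the number of boxes directly to its right, directly below it, plus the box itself. For a positive integer $t$, $\lambda$ is a $t$-core if none of its hook lengths is divisible by $t$; an $(s,t)$-core is both an $s$-core and a $t$-core. $\mathcal{C}_{n,dn+1}$ is the set of $(n,dn+1)$-core partitions with distinct parts. For integers $d\ge1$, $N\ge0$ let $\mathcal{A}_{d,N}=\{(i,j):1\le i\le d,\ 1\le j\le N\}$. A subset $I\subseteq\mathcal{A}_{d,N}$ is nice if (1) $(i+1,j)\in I$ with $i\ge1$ implies $(i,j)\in I$, and (2) $(1,j)\in I$ with $1\le j\le N-1$ implies $(1,j+1)\notin I$. $\mathcal{B}^+_{d,N}$ denotes the set of nice subsets of $\mathcal{A}_{d,N}$, and $|I|$ the cardinality of $I$. -}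

module Defs where

open import Data.Nat as ℕ using (ℕ; zero; suc; _+_; _*_; _∸_; _<_; _≤_; _≥_; _>_; _<?_)
open import Data.Nat.Divisibility using (_∣_)
open import Data.Integer using (+_)
open import Data.Rational as ℚ using (ℚ; 0ℚ; 1ℚ; _/_)
open import Data.Bool using (Bool; true; false; if_then_else_)
open import Data.Product using (_×_; _,_)
open import Data.List using (List; []; _∷_; length; filter; map; upTo; concatMap; foldr)
open import Data.Nat.ListAction using (sum)
open import Data.List.Relation.Unary.All using (All)
open import Data.List.Relation.Unary.Linked using (Linked)
open import Data.Vec using (Vec; lookup)
open import Data.Fin using (fromℕ<)
open import Relation.Nullary using (¬_; yes; no)
open import Relation.Binary.PropositionalEquality using (_≡_)

IsPartition : List ℕ → Set
IsPartition λ′ = Linked _≥_ λ′ × All (0 <_) λ′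

HasDistinctParts : List ℕ → Set
HasDistinctParts λ′ = Linked _>_ λ′

size : List ℕ → ℕ
size = sum

-- length of row i (0-based), 0 if out of range
rowAt : List ℕ → ℕ → ℕ
rowAt []       _       = 0
rowAt (r ∷ _)  zero    = r
rowAt (_ ∷ rs) (suc i) = rowAt rs i

colLen : List ℕ → ℕ → ℕ
colLen λ′ j = length (filter (j <?_) λ′)

IsBox : List ℕ → ℕ → ℕ → Set
IsBox λ′ i j = j < rowAt λ′ i

-- hook length of box (i , j): arm + leg + 1
hook : List ℕ → ℕ → ℕ → ℕ
hook λ′ i j = (rowAt λ′ i ∸ suc j) + (colLen λ′ j ∸ suc i) + 1

IsCore : ℕ → List ℕ → Set
IsCore t λ′ = ∀ i j → IsBox λ′ i j → ¬ (t ∣ hook λ′ i j)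

InC : ℕ → ℕ → List ℕ → Set
InC n d λ′ = IsPartition λ′ × HasDistinctParts λ′ × IsCore n λ′ × IsCore (d * n + 1) λ′

-- Subsets of A_{d,N} = {1..d} × {1..N} as d × N Boolean matrices;
-- row i, column j (1-based) belongs to I iff mem I i j ≡ true.

mem : ∀ {d N} → Vec (Vec Bool N) d → ℕ → ℕ → Bool
mem _ zero _ = false
mem _ (suc _) zero = false
mem {d} {N} I (suc i) (suc j) with i <? d | j <? N
... | yes p | yes q = lookup (lookup I (fromℕ< p)) (fromℕ< q)
... | _     | _     = false

IsNice : ∀ {d N} → Vec (Vec Bool N) d → Set
IsNice {d} {N} I =
  (∀ i j → 1 ≤ i → mem I (suc i) j ≡ true → mem I i j ≡ true) ×
  (∀ j → 1 ≤ j → j ≤ N ∸ 1 → mem I 1 j ≡ true → ¬ (mem I 1 (suc j) ≡ true))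

boxesA : ℕ → ℕ → List (ℕ × ℕ)
boxesA d N = concatMap (λ i → map (λ j → (suc i , suc j)) (upTo N)) (upTo d)

card : ∀ {d N} → Vec (Vec Bool N) d → ℕ
card {d} {N} I = sum (map (λ { (i , j) → if mem I i j then 1 else 0 }) (boxesA d N))

weight : ∀ {d N} → ℕ → Vec (Vec Bool N) d → ℕ
weight {d} {N} n I =
  sum (map (λ { (i , j) → if mem I i j then (i ∸ 1) * n + j else 0 }) (boxesA d N))

fromℕ : ℕ → ℚ
fromℕ m = + m / 1

powℚ : ℚ → ℕ → ℚ
powℚ q zero    = 1ℚ
powℚ q (suc k) = q ℚ.* powℚ q k

sumℚ : List ℚ → ℚ
sumℚ = foldr ℚ._+_ 0ℚ

summand : ∀ {d N} → ℕ → Vec (Vec Bool N) d → ℚ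
summand n I = (fromℕ (weight n I) ℚ.- (+ (card I * card I) / 2)) ℚ.+ (+ card I / 2)

-- The proof is a size-preserving bijection, through β-sets.  A partition
-- μ₁ ≥ … ≥ μ_ℓ is encoded by its first-column hook lengths β(μ) = {μ_i + ℓ − i}
-- (βof, with inverse λof on strictly decreasing lists).  We show that the
-- hooks of a row with first-column hook x are the numbers x − y, y < x, y ∉ β(μ);
-- hence μ is a t-core iff t ∤ x − y for all such x, y (isCore⇔betaCore).  Positive
-- and distinct parts become 0 ∉ β and "no two consecutive entries", and
-- 2|μ| + ℓ² = 2Σβ + ℓ (size-λof).  Encoding a cell (i , j) of A_{d,n−1} by (i−1)n + j,
-- the β-set of a nice matrix I (betaSet) satisfies CoreBetaSet (FromNice), and
-- every list satisfying it is the β-set of exactly one nice matrix (FromCore,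
-- betaSet-injective).  So I ↦ λof (betaSet I) is a bijection from the nice
-- matrices onto C_{n,dn+1} carrying the summand of I to the size of its image
-- (summand≡size).
module Submission where

open import Defs
open import Data.Nat using (ℕ; zero; suc; _+_; _*_; _∸_; _≤_; _<_; _≥_; _>_; z≤n; s≤s; _<?_; _≤?_; _≟_; NonZero; >-nonZero)
open import Data.Nat.Properties
open import Data.Nat.Tactic.RingSolver using (solve-∀)
open import Data.Nat.Divisibility using (_∣_; divides; ∣⇒≤)
open import Data.Nat.DivMod using (_/_; _%_; m≡m%n+[m/n]*n; m%n<n; [m+kn]%n≡m%n; m<n⇒m%n≡m)
open import Data.Nat.ListAction using (sum)
import Data.Nat.ListAction.Properties as Sum
open import Data.Integer as ℤ using (ℤ; +_)
import Data.Integer.Properties as ℤP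
open import Data.Integer.Tactic.RingSolver using () renaming (solve-∀ to ℤ-solve-∀)
import Data.Rational as ℚ
import Data.Rational.Properties as ℚP
open import Data.Rational.Unnormalised as ℚᵘ using (mkℚᵘ; *≡*)
import Data.Rational.Unnormalised.Properties as ℚᵘP
open import Data.Bool using (Bool; true; false; if_then_else_)
import Data.Bool as Bool
open import Data.Vec as Vec using (Vec; lookup; tabulate)
import Data.Vec.Properties as Vec
open import Data.Fin using (Fin; toℕ; fromℕ<)
import Data.Fin.Properties as Fin
open import Data.List using (List; []; _∷_; length; filter; map; upTo; reverse; cartesianProductWith)
import Data.List.Properties as List
import Data.List.Relation.Binary.Permutation.Propositional.Properties as Perm
open import Data.List.Membership.Propositional using (_∈_; _∉_)
import Data.List.Membership.Propositional.Properties as Mem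
open import Data.List.Membership.DecPropositional _≟_ using (_∈?_)
open import Data.List.Relation.Unary.Any using (here; there)
import Data.List.Relation.Unary.Any.Properties as Any
open import Data.List.Relation.Unary.All as All using (All; []; _∷_)
open import Data.List.Relation.Unary.AllPairs using (AllPairs; []; _∷_)
import Data.List.Relation.Unary.AllPairs.Properties as AllPairs
open import Data.List.Relation.Unary.Linked using (Linked; []; [-]; _∷_)
import Data.List.Relation.Unary.Linked.Properties as Linked
open import Data.List.Relation.Unary.Unique.Propositional using (Unique)
import Data.List.Relation.Unary.Unique.Propositional.Properties as Unique
open import Data.Product using (Σ; _×_; _,_; proj₁; proj₂)
open import Data.Product.Function.NonDependent.Propositional using (_×-⇔_)
open import Data.Empty using (⊥; ⊥-elim)
open import Relation.Nullary using (¬_; yes; no; Dec; does; ¬?; _×-dec_; _→-dec_)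
import Relation.Nullary.Decidable as Dec
open import Relation.Binary.PropositionalEquality using (_≡_; refl; sym; trans; cong; cong₂; subst; subst₂; module ≡-Reasoning)
open import Function.Bundles using (_⇔_; mk⇔; Equivalence)
import Function.Properties.Equivalence as ⇔

divMod-unique : ∀ {n} .{{_ : NonZero n}} a b a′ b′ → b < n → b′ < n →
                a * n + b ≡ a′ * n + b′ → a ≡ a′ × b ≡ b′
divMod-unique {n} a b a′ b′ b<n b′<n e = quotients , remainders
  where
  remainder : ∀ q r → r < n → (q * n + r) % n ≡ r
  remainder q r r<n = trans (cong (_% n) (+-comm (q * n) r))
                            (trans ([m+kn]%n≡m%n r q n) (m<n⇒m%n≡m r<n))
  remainders : b ≡ b′
  remainders = trans (sym (remainder a b b<n)) (trans (cong (_% n) e) (remainder a′ b′ b′<n))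
  quotients : a ≡ a′
  quotients = *-cancelʳ-≡ a a′ n
    (+-cancelʳ-≡ b (a * n) (a′ * n) (trans e (cong (_+_ (a′ * n)) (sym remainders))))

<⇒≤∸1 : ∀ {m M} → m < M → m ≤ M ∸ 1
<⇒≤∸1 {M = suc M} (s≤s m≤M) = m≤M

reverse-allPairs : ∀ {A : Set} {R : A → A → Set} xs → AllPairs R xs → AllPairs (λ a b → R b a) (reverse xs)
reverse-allPairs []       _           = []
reverse-allPairs {R = R} (x ∷ xs) (x~xs ∷ ap) = subst (AllPairs (λ a b → R b a)) (sym (List.unfold-reverse x xs))
  (AllPairs.++⁺ (reverse-allPairs xs ap) ([] ∷ []) (All.tabulate (λ m → All.lookup x~xs (Any.reverse⁻ m) ∷ [])))

sum-if : ∀ {A : Set} (g : A → Bool) (v f : A → ℕ) xs → (∀ x → f x ≡ (if g x then v x else 0)) →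
         sum (map f xs) ≡ sum (map v (filter (λ x → g x Bool.≟ true) xs))
sum-if g v f []       f≡ = refl
sum-if g v f (x ∷ xs) f≡ rewrite f≡ x with g x
... | true  = cong (_+_ (v x)) (sum-if g v f xs f≡)
... | false = sum-if g v f xs f≡

sum-ones : ∀ {A : Set} (xs : List A) → sum (map (λ _ → 1) xs) ≡ length xs
sum-ones []       = refl
sum-ones (_ ∷ xs) = cong suc (sum-ones xs)

does-true⇒ : ∀ {A : Set} (a? : Dec A) → does a? ≡ true → A
does-true⇒ (yes a) _  = a
does-true⇒ (no _)  ()

bool-ext : ∀ {x y : Bool} → (x ≡ true → y ≡ true) → (y ≡ true → x ≡ true) → x ≡ y
bool-ext {true}  {true}  _ _ = refl
bool-ext {true}  {false} f _ = sym (f refl)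
bool-ext {false} {true}  _ g = g refl
bool-ext {false} {false} _ _ = refl

vectors : ∀ {A : Set} → List A → ∀ m → List (Vec A m)
vectors xs zero    = Vec.[] ∷ []
vectors xs (suc m) = cartesianProductWith Vec._∷_ xs (vectors xs m)

vectors-complete : ∀ {A : Set} {xs : List A} → (∀ x → x ∈ xs) → ∀ m (v : Vec A m) → v ∈ vectors xs m
vectors-complete all zero    Vec.[]       = here refl
vectors-complete all (suc m) (x Vec.∷ v) = Mem.∈-cartesianProductWith⁺ Vec._∷_ (all x) (vectors-complete all m v)

vectors-unique : ∀ {A : Set} {xs : List A} → Unique xs → ∀ m → Unique (vectors xs m)
vectors-unique u zero    = [] ∷ []
vectors-unique u (suc m) = Unique.cartesianProductWith⁺ Vec._∷_ Vec.∷-injective u (vectors-unique u m)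

bools : List Bool
bools = true ∷ false ∷ []

bools-complete : ∀ b → b ∈ bools
bools-complete true  = here refl
bools-complete false = there (here refl)

bools-unique : Unique bools
bools-unique = ((λ ()) ∷ []) ∷ [] ∷ []

WeakDec : List ℕ → Set
WeakDec = Linked _≥_

StrictDec : List ℕ → Set
StrictDec = AllPairs _>_

weakDec-tail : ∀ {r l} → WeakDec (r ∷ l) → WeakDec l
weakDec-tail [-]       = []
weakDec-tail (_ ∷ wd) = wd

weakDec-head : ∀ {r l} → WeakDec (r ∷ l) → All (_≤ r) l
weakDec-head [-]        = []
weakDec-head (r≥s ∷ wd) = Linked.Linked⇒All (λ a b → ≤-trans b a) r≥s wd

strictDec-ext : ∀ xs ys → StrictDec xs → StrictDec ys →
                (∀ z → z ∈ xs → z ∈ ys) → (∀ z → z ∈ ys → z ∈ xs) → xs ≡ ys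
strictDec-ext []       []       _ _ _ _ = refl
strictDec-ext []       (y ∷ ys) _ _ _ g with g y (here refl)
... | ()
strictDec-ext (x ∷ xs) []       _ _ f _ with f x (here refl)
... | ()
strictDec-ext (x ∷ xs) (y ∷ ys) (x>xs ∷ sx) (y>ys ∷ sy) f g =
  cong₂ _∷_ x≡y (strictDec-ext xs ys sx sy (shrink f x>xs y>ys x≡y) (shrink g y>ys x>xs (sym x≡y)))
  where
  bounded : ∀ {a b bs} → All (_< b) bs → a ∈ b ∷ bs → a ≤ b
  bounded _   (here a≡b) = ≤-reflexive a≡b
  bounded b>bs (there m) = <⇒≤ (All.lookup b>bs m)
  x≡y : x ≡ y
  x≡y = ≤-antisym (bounded y>ys (f x (here refl))) (bounded x>xs (g y (here refl)))
  -- Members of the tails correspond, since the heads are equal and maximal.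
  shrink : ∀ {a b as bs} → (∀ z → z ∈ a ∷ as → z ∈ b ∷ bs) → All (_< a) as → All (_< b) bs →
           a ≡ b → ∀ z → z ∈ as → z ∈ bs
  shrink h a>as _ a≡b z m with h z (there m)
  ... | here z≡b = ⊥-elim (<-irrefl (trans z≡b (sym a≡b)) (All.lookup a>as m))
  ... | there m′ = m′

-- The β-set of a partition μ₁ ≥ … ≥ μ_ℓ is the list of first-column hook
-- lengths μ_i + (ℓ − i), listed from the top row.
βof : List ℕ → List ℕ
βof []       = []
βof (r ∷ rs) = r + length rs ∷ βof rs

-- The inverse correspondence, defined on strictly decreasing lists.
λof : List ℕ → List ℕ
λof []       = []
λof (b ∷ bs) = b ∸ length bs ∷ λof bs

length-βof : ∀ μ → length (βof μ) ≡ length μ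
length-βof []      = refl
length-βof (_ ∷ μ) = cong suc (length-βof μ)

length-λof : ∀ B → length (λof B) ≡ length B
length-λof []      = refl
length-λof (_ ∷ B) = cong suc (length-λof B)

λof∘βof : ∀ μ → λof (βof μ) ≡ μ
λof∘βof []      = refl
λof∘βof (r ∷ μ) = cong₂ _∷_
  (trans (cong (r + length μ ∸_) (length-βof μ)) (m+n∸n≡m r (length μ)))
  (λof∘βof μ)

length≤head : ∀ {b bs} → StrictDec (b ∷ bs) → length bs ≤ b
length≤head {b} {[]}     _                  = z≤n
length≤head {b} {_ ∷ _} ((b>b′ ∷ _) ∷ sd) = <-≤-trans (s≤s (length≤head sd)) b>b′

βof∘λof : ∀ B → StrictDec B → βof (λof B) ≡ B
βof∘λof []       _             = refl
βof∘λof (b ∷ bs) sd@(_ ∷ sd′) = cong₂ _∷_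
  (trans (cong (_+_ (b ∸ length bs)) (length-λof bs)) (m∸n+n≡m (length≤head sd)))
  (βof∘λof bs sd′)

βof-strictDec : ∀ μ → WeakDec μ → StrictDec (βof μ)
βof-strictDec μ wd = Linked.Linked⇒AllPairs (λ a>b b>c → <-trans b>c a>b) (linked μ wd)
  where
  linked : ∀ μ → WeakDec μ → Linked _>_ (βof μ)
  linked []          _          = []
  linked (r ∷ [])    _          = [-]
  linked (r ∷ s ∷ l) (r≥s ∷ wd) =
    subst (s + length l <_) (sym (+-suc r (length l))) (s≤s (+-monoˡ-≤ (length l) r≥s))
    ∷ linked (s ∷ l) wd

λof-weakDec : ∀ B → StrictDec B → WeakDec (λof B)
λof-weakDec []            _                    = []
λof-weakDec (b ∷ [])      _                    = [-]
λof-weakDec (b ∷ b′ ∷ bs) ((b>b′ ∷ _) ∷ sd′) =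
  ∸-monoˡ-≤ (suc (length bs)) b>b′ ∷ λof-weakDec (b′ ∷ bs) sd′

colLen-∷-< : ∀ {j s} l → j < s → colLen (s ∷ l) j ≡ suc (colLen l j)
colLen-∷-< {j} {s} l j<s = cong length (List.filter-accept (j <?_) {s} {l} j<s)

colLen-∷-≥ : ∀ {j s} l → ¬ (j < s) → colLen (s ∷ l) j ≡ colLen l j
colLen-∷-≥ {j} {s} l j≮s = cong length (List.filter-reject (j <?_) {s} {l} j≮s)

colLen≤length : ∀ l j → colLen l j ≤ length l
colLen≤length l j = List.length-filter (j <?_) l

colLen-empty : ∀ l j → All (_≤ j) l → colLen l j ≡ 0
colLen-empty []      j _          = refl
colLen-empty (s ∷ l) j (s≤j ∷ ps) =
  trans (colLen-∷-≥ l (λ j<s → <⇒≱ j<s s≤j)) (colLen-empty l j ps)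

-- The gap of column j in a first row lying above l: the hook length of
-- box (0 , j) of r ∷ l is the first-column hook r + |l| minus this gap.
gap : List ℕ → ℕ → ℕ
gap l j = j + (length l ∸ colLen l j)

gap≤ : ∀ l j → gap l j ≤ j + length l
gap≤ l j = +-monoʳ-≤ j (m∸n≤m (length l) (colLen l j))

hook-first-row : ∀ {r j} l → j < r → hook (r ∷ l) 0 j + gap l j ≡ r + length l
hook-first-row {r} {j} l j<r = begin
  hook (r ∷ l) 0 j + gap l j
    ≡⟨ cong (λ z → (r ∸ suc j) + (z ∸ 1) + 1 + gap l j) (colLen-∷-< l j<r) ⟩
  (r ∸ suc j) + c + 1 + (j + (length l ∸ c))
    ≡⟨ rearrange (r ∸ suc j) c j (length l ∸ c) ⟩
  (r ∸ suc j + suc j) + (c + (length l ∸ c))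
    ≡⟨ cong₂ _+_ (m∸n+n≡m j<r) (m+[n∸m]≡n (colLen≤length l j)) ⟩
  r + length l ∎
  where
  open ≡-Reasoning
  c : ℕ
  c = colLen l j
  rearrange : ∀ a c j e → a + c + 1 + (j + e) ≡ (a + suc j) + (c + e)
  rearrange = solve-∀

hook-first-row-∸ : ∀ {r j} l → j < r → hook (r ∷ l) 0 j ≡ (r + length l) ∸ gap l j
hook-first-row-∸ {r} {j} l j<r =
  trans (sym (m+n∸n≡m _ (gap l j))) (cong (_∸ gap l j) (hook-first-row l j<r))

rowAt≤ : ∀ {r} l i → All (_≤ r) l → rowAt l i ≤ r
rowAt≤ []      i       _          = z≤n
rowAt≤ (_ ∷ l) zero    (s≤r ∷ _)  = s≤r
rowAt≤ (_ ∷ l) (suc i) (_ ∷ l≤r)  = rowAt≤ l i l≤r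

hook-lower-row : ∀ {r} l i j → All (_≤ r) l → j < rowAt l i → hook (r ∷ l) (suc i) j ≡ hook l i j
hook-lower-row l i j l≤r box = cong (λ z → (rowAt l i ∸ suc j) + (z ∸ suc (suc i)) + 1)
  (colLen-∷-< l (<-≤-trans box (rowAt≤ l i l≤r)))

βof-bound : ∀ {r} l → WeakDec l → All (_≤ r) l → All (_< r + length l) (βof l)
βof-bound     []      _  _          = []
βof-bound {r} (s ∷ l) wd (s≤r ∷ _) =
  head< ∷ All.map (λ y< → <-trans y< head<) (βof-bound l (weakDec-tail wd) (weakDec-head wd))
  where
  head< : s + length l < r + suc (length l)
  head< = subst (s + length l <_) (sym (+-suc r (length l))) (s≤s (+-monoˡ-≤ (length l) s≤r))

gap-within : ∀ {s} l j → j < s → gap (s ∷ l) j ≡ gap l j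
gap-within l j j<s = cong (λ z → j + (suc (length l) ∸ z)) (colLen-∷-< l j<s)

gap-beyond : ∀ {s} l j → WeakDec (s ∷ l) → s ≤ j → gap (s ∷ l) j ≡ j + suc (length l)
gap-beyond l j wd s≤j = cong (λ z → j + (suc (length l) ∸ z))
  (trans (colLen-∷-≥ l (λ j<s → <⇒≱ j<s s≤j))
         (colLen-empty l j (All.map (λ q → ≤-trans q s≤j) (weakDec-head wd))))

gap∉βof : ∀ l → WeakDec l → ∀ j → gap l j ∉ βof l
gap∉βof []      _  j ()
gap∉βof (s ∷ l) wd j m with j <? s
... | yes j<s = absurd m
  where
  gap≡ : gap (s ∷ l) j ≡ gap l j
  gap≡ = gap-within l j j<s
  absurd : gap (s ∷ l) j ∈ βof (s ∷ l) → ⊥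
  absurd (here e)   = <-irrefl (trans (sym gap≡) e) (≤-<-trans (gap≤ l j) (+-monoˡ-< (length l) j<s))
  absurd (there m′) = gap∉βof l (weakDec-tail wd) j (subst (_∈ βof l) gap≡ m′)
... | no j≮s = absurd m
  where
  s≤j : s ≤ j
  s≤j = ≮⇒≥ j≮s
  gap≡ : gap (s ∷ l) j ≡ j + suc (length l)
  gap≡ = gap-beyond l j wd s≤j
  above : s + length l < gap (s ∷ l) j
  above = subst (s + length l <_) (sym (trans gap≡ (+-suc j (length l)))) (s≤s (+-monoˡ-≤ (length l) s≤j))
  absurd : gap (s ∷ l) j ∈ βof (s ∷ l) → ⊥
  absurd (here e)   = <-irrefl (sym e) above
  absurd (there m′) = <-asym (All.lookup (βof-bound l (weakDec-tail wd) (weakDec-head wd)) m′) above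

gap-onto : ∀ l → WeakDec l → ∀ r → All (_≤ r) l → ∀ y → y < r + length l → y ∉ βof l →
           Σ ℕ (λ j → j < r × gap l j ≡ y)
gap-onto []      _  r _ y y< _ = y , subst (y <_) (+-identityʳ r) y< , +-identityʳ y
gap-onto (s ∷ l) wd r (s≤r ∷ _) y y< y∉ with y <? s + length l
... | yes y<s+l with gap-onto l (weakDec-tail wd) s (weakDec-head wd) y y<s+l (λ m → y∉ (there m))
...   | j , j<s , gap≡y = j , <-≤-trans j<s s≤r ,
          trans (gap-within l j j<s) gap≡y
gap-onto (s ∷ l) wd r (s≤r ∷ _) y y< y∉ | no y≮s+l = j , j<r , gap≡y
  where
  L : ℕ
  L = length l
  s+L<y : s + L < y
  s+L<y = ≤∧≢⇒< (≮⇒≥ y≮s+l) (λ e → y∉ (here (sym e)))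
  j : ℕ
  j = y ∸ suc L
  j+L≡y : j + suc L ≡ y
  j+L≡y = m∸n+n≡m (≤-trans (s≤s (m≤n+m L s)) s+L<y)
  s≤j : s ≤ j
  s≤j = +-cancelʳ-≤ (suc L) s j (subst (s + suc L ≤_) (sym j+L≡y) (subst (_≤ y) (sym (+-suc s L)) s+L<y))
  j<r : j < r
  j<r = +-cancelʳ-< (suc L) j r (subst (_< r + suc L) (sym j+L≡y) y<)
  gap≡y : gap (s ∷ l) j ≡ y
  gap≡y = trans (gap-beyond l j wd s≤j) j+L≡y

-- No hook of a row with first-column hook x is divisible by t: the hooks of
-- that row are the differences x − y with y < x outside the β-set B.
RowFree : ℕ → ℕ → List ℕ → Set
RowFree t x B = ∀ y → y < x → y ∉ B → ¬ (t ∣ (x ∸ y))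

BetaCore : ℕ → List ℕ → Set
BetaCore t B = ∀ x → x ∈ B → RowFree t x B

FirstRowFree : ℕ → ℕ → List ℕ → Set
FirstRowFree t r l = ∀ j → j < r → ¬ (t ∣ hook (r ∷ l) 0 j)

isCore-∷ : ∀ {t r} l → WeakDec (r ∷ l) → IsCore t (r ∷ l) ⇔ (FirstRowFree t r l × IsCore t l)
isCore-∷ {t} {r} l wd = mk⇔
  (λ core → core 0 , λ i j box → subst (λ h → ¬ (t ∣ h)) (lower i j box) (core (suc i) j box))
  λ { (first , rest) zero    j box → first j box
    ; (first , rest) (suc i) j box → subst (λ h → ¬ (t ∣ h)) (sym (lower i j box)) (rest i j box) }
  where
  lower : ∀ i j → j < rowAt l i → hook (r ∷ l) (suc i) j ≡ hook l i j
  lower i j = hook-lower-row l i j (weakDec-head wd)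

-- The first-row condition is the row condition for the first-column hook
-- r + |l|, because the gaps of the columns j < r are exactly the
-- non-members of βof l below r + |l|.
firstRow⇔rowFree : ∀ {t r} l → WeakDec (r ∷ l) → FirstRowFree t r l ⇔ RowFree t (r + length l) (βof l)
firstRow⇔rowFree {t} {r} l wd = mk⇔ to from
  where
  to : FirstRowFree t r l → RowFree t (r + length l) (βof l)
  to first y y< y∉ with gap-onto l (weakDec-tail wd) r (weakDec-head wd) y y< y∉
  ... | j , j<r , refl = subst (λ h → ¬ (t ∣ h)) (hook-first-row-∸ l j<r) (first j j<r)
  from : RowFree t (r + length l) (βof l) → FirstRowFree t r l
  from row j j<r = subst (λ h → ¬ (t ∣ h)) (sym (hook-first-row-∸ l j<r))
    (row (gap l j) (≤-<-trans (gap≤ l j) (+-monoˡ-< (length l) j<r)) (gap∉βof l (weakDec-tail wd) j))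

betaCore-∷ : ∀ {t b bs} → StrictDec (b ∷ bs) → BetaCore t (b ∷ bs) ⇔ (RowFree t b bs × BetaCore t bs)
betaCore-∷ {t} {b} {bs} (b>bs ∷ _) = mk⇔ to from
  where
  -- Below an entry x of B nothing equals the head b, so the two membership tests agree.
  ∉-∷ : ∀ {x y} → x ≤ b → y < x → y ∉ bs → y ∉ b ∷ bs
  ∉-∷ x≤b y<x y∉ (here y≡b) = <-irrefl y≡b (<-≤-trans y<x x≤b)
  ∉-∷ x≤b y<x y∉ (there m)  = y∉ m
  tail≤ : ∀ {x} → x ∈ bs → x ≤ b
  tail≤ m = <⇒≤ (All.lookup b>bs m)
  to : BetaCore t (b ∷ bs) → RowFree t b bs × BetaCore t bs
  to core = (λ y y<b y∉ → core b (here refl) y y<b (∉-∷ ≤-refl y<b y∉))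
          , (λ x m y y<x y∉ → core x (there m) y y<x (∉-∷ (tail≤ m) y<x y∉))
  from : RowFree t b bs × BetaCore t bs → BetaCore t (b ∷ bs)
  from (row , rest) x (here refl) y y<x y∉ = row y y<x (λ m → y∉ (there m))
  from (row , rest) x (there m)   y y<x y∉ = rest x m y y<x (λ m′ → y∉ (there m′))

isCore⇔betaCore : ∀ t μ → WeakDec μ → IsCore t μ ⇔ BetaCore t (βof μ)
isCore⇔betaCore t []      _  = mk⇔ (λ _ _ ()) (λ _ _ _ ())
isCore⇔betaCore t (r ∷ l) wd = ⇔.trans (isCore-∷ l wd)
  (⇔.trans (firstRow⇔rowFree l wd ×-⇔ isCore⇔betaCore t l (weakDec-tail wd))
           (⇔.sym (betaCore-∷ (βof-strictDec (r ∷ l) wd))))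

NoConsecutive : List ℕ → Set
NoConsecutive B = ∀ x → x ∈ B → suc x ∉ B

Separated : List ℕ → Set
Separated = AllPairs (λ a b → suc b < a)

separated⇒noConsecutive : ∀ B → Separated B → NoConsecutive B
separated⇒noConsecutive (b ∷ bs) _          x (here refl) (here e)  = <-irrefl (sym e) (n<1+n b)
separated⇒noConsecutive (b ∷ bs) (b≫ ∷ _)  x (here refl) (there m) =
  <⇒≱ (All.lookup b≫ m) (≤-trans (n≤1+n b) (n≤1+n (suc b)))
separated⇒noConsecutive (b ∷ bs) (b≫ ∷ _)  x (there m)   (here e)  = <-irrefl e (All.lookup b≫ m)
separated⇒noConsecutive (b ∷ bs) (_ ∷ sep) x (there m)   (there m′) =
  separated⇒noConsecutive bs sep x m m′

βof-separated : ∀ μ → Linked _>_ μ → Separated (βof μ)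
βof-separated μ dist = Linked.Linked⇒AllPairs (λ {a} {b} {c} b≪a c≪b → <-trans c≪b (<-trans (n<1+n b) b≪a))
                                              (linked μ dist)
  where
  linked : ∀ μ → Linked _>_ μ → Linked (λ a b → suc b < a) (βof μ)
  linked []          _           = []
  linked (r ∷ [])    _           = [-]
  linked (r ∷ s ∷ l) (r>s ∷ dist) =
    subst (_≤ r + suc (length l)) (cong suc (+-suc s (length l))) (+-monoˡ-≤ (suc (length l)) r>s)
    ∷ linked (s ∷ l) dist

βof-0∉ : ∀ μ → All (0 <_) μ → 0 ∉ βof μ
βof-0∉ (r ∷ μ) (r>0 ∷ _)  (here e)  = <-irrefl e (<-≤-trans r>0 (m≤m+n r (length μ)))
βof-0∉ (r ∷ μ) (_ ∷ μ>0) (there m) = βof-0∉ μ μ>0 m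

length<head : ∀ b bs → StrictDec (b ∷ bs) → 0 ∉ b ∷ bs → length bs < b
length<head b []         _                   0∉ = ≤∧≢⇒< z≤n (λ e → 0∉ (here e))
length<head b (b′ ∷ bs) ((b>b′ ∷ _) ∷ sd) 0∉ =
  <-≤-trans (s≤s (length<head b′ bs sd (λ m → 0∉ (there m)))) b>b′

λof-positive : ∀ B → StrictDec B → 0 ∉ B → All (0 <_) (λof B)
λof-positive []       _             _  = []
λof-positive (b ∷ bs) sd@(_ ∷ sd′) 0∉ =
  m<n⇒0<n∸m (length<head b bs sd 0∉) ∷ λof-positive bs sd′ (λ m → 0∉ (there m))

λof-distinct : ∀ B → StrictDec B → NoConsecutive B → Linked _>_ (λof B)
λof-distinct []            _                    _     = []
λof-distinct (b ∷ [])      _                    _     = [-]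
λof-distinct (b ∷ b′ ∷ bs) ((b>b′ ∷ _) ∷ sd′) noCons =
  part> ∷ λof-distinct (b′ ∷ bs) sd′ (λ x m m′ → noCons x (there m) (there m′))
  where
  L : ℕ
  L = length bs
  b′+1<b : suc (suc b′) ≤ b
  b′+1<b = ≤∧≢⇒< b>b′ (λ e → noCons b′ (there (here refl)) (here e))
  part> : suc (b′ ∸ L) ≤ b ∸ suc L
  part> = subst (_≤ b ∸ suc L) (+-∸-assoc 1 (length≤head sd′)) (∸-monoˡ-≤ (suc L) b′+1<b)

-- |λof B| = Σ B − ℓ(ℓ − 1)/2 for ℓ = |B|, stated without division or subtraction.
size-λof : ∀ B → StrictDec B → 2 * size (λof B) + length B * length B ≡ 2 * size B + length B
size-λof []       _             = refl
size-λof (b ∷ bs) sd@(_ ∷ sd′) = begin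
  2 * (b ∸ L + size (λof bs)) + suc L * suc L
    ≡⟨ expand (b ∸ L) L (size (λof bs)) ⟩
  (2 * size (λof bs) + L * L) + (2 * (b ∸ L) + 2 * L + 1)
    ≡⟨ cong (_+ (2 * (b ∸ L) + 2 * L + 1)) (size-λof bs sd′) ⟩
  (2 * size bs + L) + (2 * (b ∸ L) + 2 * L + 1)
    ≡⟨ collect (b ∸ L) L (size bs) ⟩
  2 * ((b ∸ L + L) + size bs) + suc L
    ≡⟨ cong (λ z → 2 * (z + size bs) + suc L) (m∸n+n≡m (length≤head sd)) ⟩
  2 * (b + size bs) + suc L ∎
  where
  open ≡-Reasoning
  L : ℕ
  L = length bs
  expand : ∀ a L S → 2 * (a + S) + suc L * suc L ≡ (2 * S + L * L) + (2 * a + 2 * L + 1)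
  expand = solve-∀
  collect : ∀ a L T → (2 * T + L) + (2 * a + 2 * L + 1) ≡ 2 * ((a + L) + T) + suc L
  collect = solve-∀

record CoreBetaSet (n d : ℕ) (B : List ℕ) : Set where
  field
    strictDec     : StrictDec B
    zero∉         : 0 ∉ B
    noConsecutive : NoConsecutive B
    nCore         : BetaCore n B
    dn+1Core      : BetaCore (d * n + 1) B

inC⇒coreBetaSet : ∀ n d μ → InC n d μ → CoreBetaSet n d (βof μ)
inC⇒coreBetaSet n d μ ((wd , pos) , dist , nCore , dn+1Core) = record
  { strictDec     = βof-strictDec μ wd
  ; zero∉         = βof-0∉ μ pos
  ; noConsecutive = separated⇒noConsecutive (βof μ) (βof-separated μ dist)
  ; nCore         = Equivalence.to (isCore⇔betaCore n μ wd) nCore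
  ; dn+1Core      = Equivalence.to (isCore⇔betaCore (d * n + 1) μ wd) dn+1Core
  }

coreBetaSet⇒inC : ∀ n d B → CoreBetaSet n d B → InC n d (λof B)
coreBetaSet⇒inC n d B cb = (wd , λof-positive B strictDec zero∉) , λof-distinct B strictDec noConsecutive
                         , core n nCore , core (d * n + 1) dn+1Core
  where
  open CoreBetaSet cb
  wd : WeakDec (λof B)
  wd = λof-weakDec B strictDec
  core : ∀ t → BetaCore t B → IsCore t (λof B)
  core t bc = Equivalence.from (isCore⇔betaCore t (λof B) wd) (subst (BetaCore t) (sym (βof∘λof B strictDec)) bc)

-- The integer identity to which half-formula reduces after cross-multiplying:
-- (2w − q)·2 + 2c = 4s whenever 2s + q = 2w + c.
half-formula-ℤ : ∀ (w q c s : ℤ) → + 2 ℤ.* s ℤ.+ q ≡ + 2 ℤ.* w ℤ.+ c →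
  ((w ℤ.* + 2 ℤ.+ (ℤ.- q) ℤ.* + 1) ℤ.* + 2 ℤ.+ c ℤ.* + 2) ℤ.* + 1 ≡ s ℤ.* + 4
half-formula-ℤ w q c s hyp = begin
  ((w ℤ.* + 2 ℤ.+ (ℤ.- q) ℤ.* + 1) ℤ.* + 2 ℤ.+ c ℤ.* + 2) ℤ.* + 1 ≡⟨ expand w q c ⟩
  + 2 ℤ.* (+ 2 ℤ.* w ℤ.+ c) ℤ.- + 2 ℤ.* q                         ≡⟨ cong (λ z → + 2 ℤ.* z ℤ.- + 2 ℤ.* q) (sym hyp) ⟩
  + 2 ℤ.* (+ 2 ℤ.* s ℤ.+ q) ℤ.- + 2 ℤ.* q                         ≡⟨ collect q s ⟩
  s ℤ.* + 4                                                         ∎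
  where
  open ≡-Reasoning
  expand : ∀ w q c → ((w ℤ.* + 2 ℤ.+ (ℤ.- q) ℤ.* + 1) ℤ.* + 2 ℤ.+ c ℤ.* + 2) ℤ.* + 1
                     ≡ + 2 ℤ.* (+ 2 ℤ.* w ℤ.+ c) ℤ.- + 2 ℤ.* q
  expand = ℤ-solve-∀
  collect : ∀ q s → + 2 ℤ.* (+ 2 ℤ.* s ℤ.+ q) ℤ.- + 2 ℤ.* q ≡ s ℤ.* + 4
  collect = ℤ-solve-∀

pos-2a+b : ∀ a b → + (2 * a + b) ≡ + 2 ℤ.* + a ℤ.+ + b
pos-2a+b a b = trans (ℤP.pos-+ (2 * a) b) (cong (ℤ._+ + b) (ℤP.pos-* 2 a))

-- W − c²/2 + c/2 = S in ℚ whenever 2S + c² = 2W + c in ℕ; computed in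
-- unnormalised rationals, where the equation reduces to half-formula-ℤ.
half-formula : ∀ W c S → 2 * S + c * c ≡ 2 * W + c →
               (fromℕ W ℚ.- (+ (c * c) ℚ./ 2)) ℚ.+ (+ c ℚ./ 2) ≡ fromℕ S
half-formula W c S h = ℚP.toℚᵘ-injective (begin
  ℚ.toℚᵘ ((fromℕ W ℚ.- c²/2) ℚ.+ c/2)
    ≈⟨ ℚP.toℚᵘ-homo-+ (fromℕ W ℚ.- c²/2) c/2 ⟩
  ℚ.toℚᵘ (fromℕ W ℚ.- c²/2) ℚᵘ.+ ℚ.toℚᵘ c/2
    ≈⟨ ℚᵘP.+-cong (ℚᵘP.≃-trans (ℚP.toℚᵘ-homo-+ (fromℕ W) (ℚ.- c²/2))
                     (ℚᵘP.+-cong (ℚP.toℚᵘ-fromℚᵘ (mkℚᵘ (+ W) 0))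
                                 (ℚᵘP.≃-trans (ℚP.toℚᵘ-homo‿- c²/2) (ℚᵘP.-‿cong (ℚP.toℚᵘ-fromℚᵘ (mkℚᵘ (+ (c * c)) 1))))))
                  (ℚP.toℚᵘ-fromℚᵘ (mkℚᵘ (+ c) 1)) ⟩
  (mkℚᵘ (+ W) 0 ℚᵘ.+ ℚᵘ.- mkℚᵘ (+ (c * c)) 1) ℚᵘ.+ mkℚᵘ (+ c) 1
    ≈⟨ *≡* (half-formula-ℤ (+ W) (+ (c * c)) (+ c) (+ S) h-ℤ) ⟩
  mkℚᵘ (+ S) 0
    ≈⟨ ℚᵘP.≃-sym (ℚP.toℚᵘ-fromℚᵘ (mkℚᵘ (+ S) 0)) ⟩
  ℚ.toℚᵘ (fromℕ S) ∎)
  where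
  open ℚᵘP.≃-Reasoning
  c²/2 : ℚ.ℚ
  c²/2 = + (c * c) ℚ./ 2
  c/2 : ℚ.ℚ
  c/2 = + c ℚ./ 2
  h-ℤ : + 2 ℤ.* + S ℤ.+ + (c * c) ≡ + 2 ℤ.* + W ℤ.+ + c
  h-ℤ = trans (sym (pos-2a+b S (c * c))) (trans (cong +_ h) (pos-2a+b W c))

-- Subsets of A_{d,N} as d × N Boolean matrices, with n = N + 1 so that N = n − 1.
module Matrices (N d : ℕ) where

  n : ℕ
  n = suc N

  Matrix : Set
  Matrix = Vec (Vec Bool N) d

  mem-lookup : ∀ (I : Matrix) a b (p : a < d) (q : b < N) →
               mem I (suc a) (suc b) ≡ lookup (lookup I (fromℕ< p)) (fromℕ< q)
  mem-lookup I a b p q with a <? d | b <? N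
  ... | yes _ | yes _ = refl
  ... | no ¬p | _     = ⊥-elim (¬p p)
  ... | yes _ | no ¬q = ⊥-elim (¬q q)

  mem-inRange : ∀ (I : Matrix) i j → mem I i j ≡ true →
                Σ ℕ (λ a → Σ ℕ (λ b → i ≡ suc a × j ≡ suc b × a < d × b < N))
  mem-inRange I (suc a) (suc b) e with a <? d | b <? N
  mem-inRange I (suc a) (suc b) e  | yes p | yes q = a , b , refl , refl , p , q
  mem-inRange I (suc a) (suc b) () | no _  | _
  mem-inRange I (suc a) (suc b) () | yes _ | no _

  matrix-ext : ∀ (I I′ : Matrix) → (∀ a b → a < d → b < N → mem I (suc a) (suc b) ≡ mem I′ (suc a) (suc b)) → I ≡ I′
  matrix-ext I I′ same = trans (sym (Vec.tabulate∘lookup I)) (trans (Vec.tabulate-cong row) (Vec.tabulate∘lookup I′))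
    where
    entry : ∀ i j → lookup (lookup I i) j ≡ lookup (lookup I′ i) j
    entry i j = subst₂ (λ u v → lookup (lookup I u) v ≡ lookup (lookup I′ u) v) (Fin.fromℕ<-toℕ i p) (Fin.fromℕ<-toℕ j q)
      (trans (sym (mem-lookup I _ _ p q)) (trans (same _ _ p q) (mem-lookup I′ _ _ p q)))
      where
      p : toℕ i < d
      p = Fin.toℕ<n i
      q : toℕ j < N
      q = Fin.toℕ<n j
    row : ∀ i → lookup I i ≡ lookup I′ i
    row i = trans (sym (Vec.tabulate∘lookup (lookup I i))) (trans (Vec.tabulate-cong (entry i)) (Vec.tabulate∘lookup (lookup I′ i)))

  code : ℕ × ℕ → ℕ
  code (i , j) = (i ∸ 1) * n + j

  IsSet : Matrix → ℕ × ℕ → Set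
  IsSet I (i , j) = mem I i j ≡ true

  set? : (I : Matrix) → (c : ℕ × ℕ) → Dec (IsSet I c)
  set? I (i , j) = mem I i j Bool.≟ true

  -- The β-set of I: the codes of its set cells, in decreasing order.
  -- (boxesA lists the cells in increasing order of codes.)
  codes : Matrix → List ℕ
  codes I = map code (filter (set? I) (boxesA d N))

  betaSet : Matrix → List ℕ
  betaSet I = reverse (codes I)

  row : ℕ → List (ℕ × ℕ)
  row a = map (λ b → (suc a , suc b)) (upTo N)

  boxesA-complete : ∀ a b → a < d → b < N → (suc a , suc b) ∈ boxesA d N
  boxesA-complete a b a<d b<N =
    Mem.∈-concat⁺′ (Mem.∈-map⁺ (λ j → (suc a , suc j)) (Mem.∈-upTo⁺ b<N)) (Mem.∈-map⁺ row (Mem.∈-upTo⁺ a<d))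

  boxesA-sound : ∀ c → c ∈ boxesA d N → Σ ℕ (λ a → Σ ℕ (λ b → a < d × b < N × c ≡ (suc a , suc b)))
  boxesA-sound c m with Mem.∈-concat⁻′ (map row (upTo d)) m
  ... | cs , c∈cs , cs∈ with Mem.∈-map⁻ row cs∈
  ...   | a , a∈ , refl with Mem.∈-map⁻ (λ j → (suc a , suc j)) c∈cs
  ...     | b , b∈ , c≡ = a , b , Mem.∈-upTo⁻ a∈ , Mem.∈-upTo⁻ b∈ , c≡

  Encodes : Matrix → ℕ → Set
  Encodes I x = Σ ℕ (λ a → Σ ℕ (λ b → a < d × b < N × mem I (suc a) (suc b) ≡ true × x ≡ a * n + suc b))

  betaSet-sound : ∀ I x → x ∈ betaSet I → Encodes I x
  betaSet-sound I x m with Mem.∈-map⁻ code (Any.reverse⁻ {xs = codes I} m)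
  ... | c , c∈ , refl with Mem.∈-filter⁻ (set? I) c∈
  ...   | c∈A , set with boxesA-sound c c∈A
  ...     | a , b , a<d , b<N , refl = a , b , a<d , b<N , set , refl

  betaSet-complete : ∀ I x → Encodes I x → x ∈ betaSet I
  betaSet-complete I x (a , b , a<d , b<N , set , refl) =
    Any.reverse⁺ {xs = codes I} (Mem.∈-map⁺ code (Mem.∈-filter⁺ (set? I) (boxesA-complete a b a<d b<N) set))

  code∈betaSet⇒set : ∀ I a b → b < N → a * n + suc b ∈ betaSet I → mem I (suc a) (suc b) ≡ true
  code∈betaSet⇒set I a b b<N m with betaSet-sound I _ m
  ... | a′ , b′ , _ , b′<N , set , e with divMod-unique a (suc b) a′ (suc b′) (s≤s b<N) (s≤s b′<N) e
  ...   | refl , refl = set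

  betaSet-injective : ∀ I I′ → betaSet I ≡ betaSet I′ → I ≡ I′
  betaSet-injective I I′ e = matrix-ext I I′ λ a b a<d b<N → bool-ext
    (λ set → code∈betaSet⇒set I′ a b b<N (subst (_ ∈_) e (betaSet-complete I _ (a , b , a<d , b<N , set , refl))))
    (λ set → code∈betaSet⇒set I a b b<N (subst (_ ∈_) (sym e) (betaSet-complete I′ _ (a , b , a<d , b<N , set , refl))))

  code<next-row : ∀ a b → b < N → a * n + suc b < suc a * n
  code<next-row a b b<N = subst (a * n + suc b <_) (+-comm (a * n) n) (+-monoʳ-< (a * n) (s≤s b<N))

  code-rowwise : ∀ a a′ b b′ → a < a′ → b < N → a * n + suc b < a′ * n + suc b′
  code-rowwise a a′ b b′ a<a′ b<N = begin-strict
      a * n + suc b   <⟨ code<next-row a b b<N ⟩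
      suc a * n       ≤⟨ *-monoˡ-≤ n a<a′ ⟩
      a′ * n          ≤⟨ m≤m+n (a′ * n) (suc b′) ⟩
      a′ * n + suc b′ ∎
    where open ≤-Reasoning

  CodeLess : ℕ × ℕ → ℕ × ℕ → Set
  CodeLess c c′ = code c < code c′

  boxesA-increasing : AllPairs CodeLess (boxesA d N)
  boxesA-increasing = AllPairs.concat⁺ (All.tabulate within) across
    where
    within : ∀ {cs} → cs ∈ map row (upTo d) → AllPairs CodeLess cs
    within m with Mem.∈-map⁻ row m
    ... | a , _ , refl = AllPairs.map⁺ (AllPairs.applyUpTo⁺₁ (λ x → x) N (λ i<j _ → +-monoʳ-< (a * n) (s≤s i<j)))
    lt : ∀ a a′ → a < a′ → ∀ c c′ → c ∈ row a → c′ ∈ row a′ → CodeLess c c′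
    lt a a′ a<a′ c c′ cm c′m with Mem.∈-map⁻ (λ j → (suc a , suc j)) cm | Mem.∈-map⁻ (λ j → (suc a′ , suc j)) c′m
    ... | b , bm , refl | b′ , _ , refl = code-rowwise a a′ b b′ a<a′ (Mem.∈-upTo⁻ bm)
    across : AllPairs (λ cs cs′ → All (λ c → All (CodeLess c) cs′) cs) (map row (upTo d))
    across = AllPairs.map⁺ (AllPairs.applyUpTo⁺₁ (λ x → x) d (λ {a} {a′} a<a′ _ →
      All.tabulate (λ {c} cm → All.tabulate (λ {c′} c′m → lt a a′ a<a′ c c′ cm c′m))))

  betaSet-strictDec : ∀ I → StrictDec (betaSet I)
  betaSet-strictDec I = reverse-allPairs _ (AllPairs.map⁺ (AllPairs.filter⁺ (set? I) boxesA-increasing))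

  weight≡size : ∀ I → weight n I ≡ size (betaSet I)
  weight≡size I = trans (sum-if (λ c → mem I (proj₁ c) (proj₂ c)) code _ (boxesA d N) (λ { (i , j) → refl }))
                        (sym (Sum.sum-↭ (Perm.↭-reverse (codes I))))

  card≡length : ∀ I → card I ≡ length (betaSet I)
  card≡length I = begin
    card I                                    ≡⟨ sum-if (λ c → mem I (proj₁ c) (proj₂ c)) (λ _ → 1) _ (boxesA d N) (λ { (i , j) → refl }) ⟩
    sum (map (λ _ → 1) (filter (set? I) cells)) ≡⟨ sum-ones (filter (set? I) cells) ⟩
    length (filter (set? I) cells)            ≡⟨ sym (List.length-map code (filter (set? I) cells)) ⟩
    length (codes I)                          ≡⟨ sym (List.length-reverse (codes I)) ⟩
    length (betaSet I)                        ∎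
    where
    open ≡-Reasoning
    cells : List (ℕ × ℕ)
    cells = boxesA d N

  module FromNice (I : Matrix) (nice : IsNice I) where

    B : List ℕ
    B = betaSet I

    column-closed : ∀ k a j → mem I (suc (k + a)) j ≡ true → mem I (suc a) j ≡ true
    column-closed zero    a j set = set
    column-closed (suc k) a j set = column-closed k a j (proj₁ nice (suc (k + a)) j (s≤s z≤n) set)

    zero∉ : 0 ∉ B
    zero∉ m with betaSet-sound I 0 m
    ... | a , b , _ , _ , _ , e = 0≢1+n (trans e (+-suc (a * n) b))

    set-in-row-1 : ∀ a j → mem I (suc a) j ≡ true → mem I 1 j ≡ true
    set-in-row-1 a j set = column-closed a 0 j (subst (λ z → mem I (suc z) j ≡ true) (sym (+-identityʳ a)) set)

    -- x and x + 1 in B would either straddle a row boundary (remainder 0,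
    -- impossible) or be adjacent cells of one row, forcing adjacent cells in row 1.
    noConsecutive : NoConsecutive B
    noConsecutive x xm x+1m with betaSet-sound I x xm | betaSet-sound I (suc x) x+1m
    ... | a , b , _ , b<N , set , refl | a′ , b′ , _ , b′<N , set′ , x+1≡ with suc b <? N
    ...   | no b+1≮N = 0≢1+n (proj₂ (divMod-unique (suc a) 0 a′ (suc b′) (s≤s z≤n) (s≤s b′<N)
                                   (trans (sym boundary) (trans (+-suc (a * n) (suc b)) x+1≡))))
      where
      boundary : a * n + suc (suc b) ≡ suc a * n + 0
      boundary = trans (cong (λ z → a * n + suc z) (≤-antisym b<N (≮⇒≥ b+1≮N)))
                       (trans (+-comm (a * n) n) (sym (+-identityʳ (suc a * n))))
    ...   | yes b+1<N with divMod-unique a (suc (suc b)) a′ (suc b′) (s≤s b+1<N) (s≤s b′<N)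
                                         (trans (+-suc (a * n) (suc b)) x+1≡)
    ...     | refl , refl = proj₂ nice (suc b) (s≤s z≤n) (<⇒≤∸1 b+1<N)
                              (set-in-row-1 a (suc b) set) (set-in-row-1 a (suc (suc b)) set′)

    -- If n ∣ x − y for x = a n + (b + 1) in B, then y = (a − m) n + (b + 1)
    -- encodes a cell of the same column in a lower row, hence y ∈ B.
    nCore : BetaCore n B
    nCore x xm y y<x y∉ (divides m x−y≡mn) with betaSet-sound I x xm
    ... | a , b , a<d , b<N , set , refl =
      y∉ (betaSet-complete I y (k , b , k<d , b<N , column-closed m k (suc b) set′ , y≡))
      where
      m≤a : m ≤ a
      m≤a = ≤-pred (*-cancelʳ-< n m (suc a)
              (≤-<-trans (subst (_≤ x) x−y≡mn (m∸n≤m x y)) (code<next-row a b b<N)))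
      k : ℕ
      k = a ∸ m
      a≡m+k : a ≡ m + k
      a≡m+k = sym (m+[n∸m]≡n m≤a)
      k<d : k < d
      k<d = ≤-<-trans (m∸n≤m a m) a<d
      set′ : mem I (suc (m + k)) (suc b) ≡ true
      set′ = subst (λ z → mem I (suc z) (suc b) ≡ true) a≡m+k set
      x≡ : x ≡ m * n + (k * n + suc b)
      x≡ = begin
        a * n + suc b           ≡⟨ cong (λ z → z * n + suc b) a≡m+k ⟩
        (m + k) * n + suc b     ≡⟨ cong (_+ suc b) (*-distribʳ-+ n m k) ⟩
        m * n + k * n + suc b   ≡⟨ +-assoc (m * n) (k * n) (suc b) ⟩
        m * n + (k * n + suc b) ∎
        where open ≡-Reasoning
      y≡ : y ≡ k * n + suc b
      y≡ = begin
        y                               ≡⟨ sym (m∸[m∸n]≡n (<⇒≤ y<x)) ⟩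
        x ∸ (x ∸ y)                     ≡⟨ cong (x ∸_) x−y≡mn ⟩
        x ∸ m * n                       ≡⟨ cong (_∸ m * n) x≡ ⟩
        m * n + (k * n + suc b) ∸ m * n ≡⟨ m+n∸m≡n (m * n) _ ⟩
        k * n + suc b                   ∎
        where open ≡-Reasoning

    -- All codes are below d n < d n + 1, so no positive difference is divisible by d n + 1.
    dn+1Core : BetaCore (d * n + 1) B
    dn+1Core x xm y y<x _ divisible with betaSet-sound I x xm
    ... | a , b , a<d , b<N , _ , refl =
      <-irrefl refl (≤-<-trans (∣⇒≤ {{>-nonZero (m<n⇒0<n∸m y<x)}} divisible) x−y<dn+1)
      where
      x−y<dn+1 : x ∸ y < d * n + 1
      x−y<dn+1 = begin-strict
        x ∸ y     ≤⟨ m∸n≤m x y ⟩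
        x         <⟨ code<next-row a b b<N ⟩
        suc a * n ≤⟨ *-monoˡ-≤ n a<d ⟩
        d * n     ≤⟨ m≤m+n (d * n) 1 ⟩
        d * n + 1 ∎
        where open ≤-Reasoning

    coreBetaSet : CoreBetaSet n d B
    coreBetaSet = record
      { strictDec     = betaSet-strictDec I
      ; zero∉         = zero∉
      ; noConsecutive = noConsecutive
      ; nCore         = nCore
      ; dn+1Core      = dn+1Core
      }

  -- Conversely, for d ≥ 1 every list satisfying the conditions of C_{n,dn+1}
  -- is the β-set of a nice matrix: the one whose set cells have codes in B.
  module FromCore (B : List ℕ) (cb : CoreBetaSet n d B) (d≥1 : 1 ≤ d) where
    open CoreBetaSet cb

    I : Matrix
    I = tabulate (λ a → tabulate (λ b → does ((toℕ a * n + suc (toℕ b)) ∈? B)))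

    entry : ∀ a b (p : a < d) (q : b < N) → mem I (suc a) (suc b) ≡ does ((a * n + suc b) ∈? B)
    entry a b p q = begin
      mem I (suc a) (suc b)                                 ≡⟨ mem-lookup I a b p q ⟩
      lookup (lookup I (fromℕ< p)) (fromℕ< q)               ≡⟨ cong (λ v → lookup v (fromℕ< q)) (Vec.lookup∘tabulate _ (fromℕ< p)) ⟩
      lookup (tabulate (λ b′ → does ((toℕ (fromℕ< p) * n + suc (toℕ b′)) ∈? B))) (fromℕ< q)
                                                            ≡⟨ Vec.lookup∘tabulate _ (fromℕ< q) ⟩
      does ((toℕ (fromℕ< p) * n + suc (toℕ (fromℕ< q))) ∈? B) ≡⟨ cong₂ (λ u v → does ((u * n + suc v) ∈? B)) (Fin.toℕ-fromℕ< p) (Fin.toℕ-fromℕ< q) ⟩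
      does ((a * n + suc b) ∈? B)                           ∎
      where open ≡-Reasoning

    set⇒∈ : ∀ a b → mem I (suc a) (suc b) ≡ true → a * n + suc b ∈ B
    set⇒∈ a b set with mem-inRange I (suc a) (suc b) set
    ... | _ , _ , refl , refl , p , q = does-true⇒ (_ ∈? B) (trans (sym (entry a b p q)) set)

    ∈⇒set : ∀ a b → a < d → b < N → a * n + suc b ∈ B → mem I (suc a) (suc b) ≡ true
    ∈⇒set a b p q m = trans (entry a b p q) (Dec.dec-true (_ ∈? B) m)

    forced : ∀ {t} → BetaCore t B → ∀ x y → x ∈ B → y < x → t ∣ (x ∸ y) → y ∈ B
    forced core x y xm y<x t∣x−y = Dec.decidable-stable (y ∈? B) (λ y∉ → core x xm y y<x y∉ t∣x−y)

    -- Every entry of B is below d n + 1: otherwise x − (dn + 1) and x − dn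
    -- would be two consecutive entries of B.
    entry<dn+1 : ∀ x → x ∈ B → x < d * n + 1
    entry<dn+1 x xm with x <? d * n + 1
    ... | yes x<dn+1 = x<dn+1
    ... | no x≮dn+1 = ⊥-elim (noConsecutive t t∈B t+1∈B)
      where
      t : ℕ
      t = x ∸ (d * n + 1)
      x≡ : x ≡ (d * n + 1) + t
      x≡ = sym (m+[n∸m]≡n (≮⇒≥ x≮dn+1))
      x≡′ : x ≡ d * n + suc t
      x≡′ = trans x≡ (+-assoc (d * n) 1 t)
      t∈B : t ∈ B
      t∈B = forced dn+1Core x t xm (subst (t <_) (sym x≡) (m<n+m t (m≤n+m 1 (d * n))))
        (divides 1 (trans (cong (_∸ t) x≡) (trans (m+n∸n≡m (d * n + 1) t) (sym (*-identityˡ _)))))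
      t+1∈B : suc t ∈ B
      t+1∈B = forced nCore x (suc t) xm (subst (suc t <_) (sym x≡′) (m<n+m (suc t) (*-mono-< d≥1 (s≤s z≤n))))
        (divides d (trans (cong (_∸ suc t) x≡′) (m+n∸n≡m (d * n) (suc t))))

    -- Hence every entry of B is the code of a cell of A_{d,N}; a remainder 0
    -- is excluded since n ∣ x − 0 would force 0 ∈ B.
    entry-cell : ∀ x → x ∈ B → Σ ℕ (λ a → Σ ℕ (λ b → a < d × b < N × x ≡ a * n + suc b))
    entry-cell x xm with x % n | m%n<n x n | m≡m%n+[m/n]*n x n
    ... | zero  | _         | x≡ = ⊥-elim (zero∉ (forced nCore x 0 xm x>0 (divides (x / n) x≡)))
      where
      x>0 : 0 < x
      x>0 = ≤∧≢⇒< z≤n (λ 0≡x → zero∉ (subst (_∈ B) (sym 0≡x) xm))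
    ... | suc b | s≤s b<N   | x≡ = x / n , b , row<d , b<N , trans x≡ (+-comm (suc b) (x / n * n))
      where
      row<d : x / n < d
      row<d = *-cancelʳ-< n (x / n) d (<-≤-trans below-x x≤dn)
        where
        below-x : x / n * n < x
        below-x = subst (x / n * n <_) (sym x≡) (m<n+m (x / n * n) (s≤s z≤n))
        x≤dn : x ≤ d * n
        x≤dn = ≤-pred (subst (x <_) (+-comm (d * n) 1) (entry<dn+1 x xm))

    betaSet≡ : betaSet I ≡ B
    betaSet≡ = strictDec-ext (betaSet I) B (betaSet-strictDec I) strictDec sound complete
      where
      sound : ∀ x → x ∈ betaSet I → x ∈ B
      sound x m with betaSet-sound I x m
      ... | a , b , _ , _ , set , refl = set⇒∈ a b set
      complete : ∀ x → x ∈ B → x ∈ betaSet I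
      complete x m with entry-cell x m
      ... | a , b , a<d , b<N , refl = betaSet-complete I x (a , b , a<d , b<N , ∈⇒set a b a<d b<N m , refl)

    -- Column closure comes from the n-core condition (x − n ∈ B), and
    -- condition (2) from the absence of consecutive entries.
    nice : IsNice I
    nice = column-closed , no-adjacent
      where
      column-closed : ∀ i j → 1 ≤ i → mem I (suc i) j ≡ true → mem I i j ≡ true
      column-closed zero    j ()  _
      column-closed (suc a) j _ set with mem-inRange I (suc (suc a)) j set
      ... | _ , b , refl , refl , a+1<d , b<N = ∈⇒set a b (<-trans (n<1+n a) a+1<d) b<N
        (forced nCore (suc a * n + suc b) (a * n + suc b) (set⇒∈ (suc a) b set) y<x (divides 1 x−y≡n))
        where
        x≡ : suc a * n + suc b ≡ (a * n + suc b) + n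
        x≡ = trans (+-assoc n (a * n) (suc b)) (+-comm n (a * n + suc b))
        y<x : a * n + suc b < suc a * n + suc b
        y<x = subst (a * n + suc b <_) (sym x≡) (m<m+n (a * n + suc b) (s≤s z≤n))
        x−y≡n : suc a * n + suc b ∸ (a * n + suc b) ≡ 1 * n
        x−y≡n = trans (cong (_∸ (a * n + suc b)) x≡) (trans (m+n∸m≡n (a * n + suc b) n) (sym (*-identityˡ n)))
      no-adjacent : ∀ j → 1 ≤ j → j ≤ N ∸ 1 → mem I 1 j ≡ true → ¬ (mem I 1 (suc j) ≡ true)
      no-adjacent j _ _ set set′ with mem-inRange I 1 j set
      ... | _ , b , refl , refl , _ , _ = noConsecutive (suc b) (set⇒∈ 0 b set) (set⇒∈ 0 (suc b) set′)

  -- Niceness is decidable: both conditions only concern the finitely many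
  -- cells i < d, j ≤ N, all others being unset.
  nice? : ∀ I → Dec (IsNice I)
  nice? I = Dec.map′ to from
    (Fin.all? (λ a → Fin.all? (λ b → closed? (toℕ a) (toℕ b))) ×-dec Fin.all? (λ b → apart? (toℕ b)))
    where
    Closed : ℕ → ℕ → Set
    Closed i j = 1 ≤ i → mem I (suc i) j ≡ true → mem I i j ≡ true
    Apart : ℕ → Set
    Apart j = 1 ≤ j → j ≤ N ∸ 1 → mem I 1 j ≡ true → ¬ (mem I 1 (suc j) ≡ true)
    closed? : ∀ i j → Dec (Closed i j)
    closed? i j = (1 ≤? i) →-dec ((mem I (suc i) j Bool.≟ true) →-dec (mem I i j Bool.≟ true))
    apart? : ∀ j → Dec (Apart j)
    apart? j = (1 ≤? j) →-dec ((j ≤? N ∸ 1) →-dec ((mem I 1 j Bool.≟ true) →-dec ¬? (mem I 1 (suc j) Bool.≟ true)))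
    at : ∀ {m} {P : ℕ → Set} → (∀ (f : Fin m) → P (toℕ f)) → ∀ i → i < m → P i
    at {P = P} h i i<m = subst P (Fin.toℕ-fromℕ< i<m) (h (fromℕ< i<m))
    to : (∀ (a : Fin d) (b : Fin n) → Closed (toℕ a) (toℕ b)) × (∀ (b : Fin n) → Apart (toℕ b)) → IsNice I
    to (closed , apart) = closedAll , apartAll
      where
      closedAll : ∀ i j → Closed i j
      closedAll i j 1≤i set with mem-inRange I (suc i) j set
      ... | _ , b , refl , refl , i<d , b<N =
        at {P = λ i → Closed i (suc b)} (λ a → at {P = Closed (toℕ a)} (closed a) (suc b) (s≤s b<N)) i i<d 1≤i set
      apartAll : ∀ j → Apart j
      apartAll j 1≤j j≤ set with mem-inRange I 1 j set
      ... | _ , b , refl , refl , _ , b<N = at {P = Apart} apart (suc b) (s≤s b<N) 1≤j j≤ set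
    from : IsNice I → (∀ (a : Fin d) (b : Fin n) → Closed (toℕ a) (toℕ b)) × (∀ (b : Fin n) → Apart (toℕ b))
    from (closed , apart) = (λ a b → closed (toℕ a) (toℕ b)) , (λ b → apart (toℕ b))

  partition : Matrix → List ℕ
  partition I = λof (betaSet I)

  partition-injective : ∀ {I I′} → partition I ≡ partition I′ → I ≡ I′
  partition-injective {I} {I′} e = betaSet-injective I I′ (begin
    betaSet I               ≡⟨ sym (βof∘λof (betaSet I) (betaSet-strictDec I)) ⟩
    βof (partition I)       ≡⟨ cong βof e ⟩
    βof (partition I′)      ≡⟨ βof∘λof (betaSet I′) (betaSet-strictDec I′) ⟩
    betaSet I′              ∎)
    where open ≡-Reasoning

  summand≡size : ∀ I → summand n I ≡ fromℕ (size (partition I))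
  summand≡size I = begin
    summand n I
      ≡⟨ cong₂ (λ W c → (fromℕ W ℚ.- (+ (c * c) ℚ./ 2)) ℚ.+ (+ c ℚ./ 2)) (weight≡size I) (card≡length I) ⟩
    (fromℕ (size (betaSet I)) ℚ.- (+ (ℓ * ℓ) ℚ./ 2)) ℚ.+ (+ ℓ ℚ./ 2)
      ≡⟨ half-formula (size (betaSet I)) ℓ (size (partition I)) (size-λof (betaSet I) (betaSet-strictDec I)) ⟩
    fromℕ (size (partition I)) ∎
    where
    open ≡-Reasoning
    ℓ : ℕ
    ℓ = length (betaSet I)

  niceMatrices : List Matrix
  niceMatrices = filter nice? (vectors (vectors bools N) d)

  niceMatrices-unique : Unique niceMatrices
  niceMatrices-unique = Unique.filter⁺ nice? (vectors-unique (vectors-unique bools-unique N) d)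

  ∈niceMatrices⇔ : ∀ I → (I ∈ niceMatrices) ⇔ IsNice I
  ∈niceMatrices⇔ I = mk⇔ (λ m → proj₂ (Mem.∈-filter⁻ nice? {xs = vectors (vectors bools N) d} m))
                         (Mem.∈-filter⁺ nice? (vectors-complete (vectors-complete bools-complete N) d I))

  ∈partitions⇔ : 1 ≤ d → ∀ μ → (μ ∈ map partition niceMatrices) ⇔ InC n d μ
  ∈partitions⇔ d≥1 μ = mk⇔ to from
    where
    to : μ ∈ map partition niceMatrices → InC n d μ
    to m with Mem.∈-map⁻ partition m
    ... | I , I∈ , refl = coreBetaSet⇒inC n d (betaSet I) (FromNice.coreBetaSet I (Equivalence.to (∈niceMatrices⇔ I) I∈))
    from : InC n d μ → μ ∈ map partition niceMatrices
    from μ∈C = subst (_∈ map partition niceMatrices) partition≡μ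
                     (Mem.∈-map⁺ partition (Equivalence.from (∈niceMatrices⇔ I) nice))
      where
      open FromCore (βof μ) (inC⇒coreBetaSet n d μ μ∈C) d≥1
      partition≡μ : partition I ≡ μ
      partition≡μ = trans (cong λof betaSet≡) (λof∘βof μ)

-- The nice matrices form LB and their partitions LC; the k-th powers of sizes
-- and summands agree termwise.
lemma3p2 : (n d k : ℕ) → 1 ≤ n → 1 ≤ d → 1 ≤ k →
    Σ (List (List ℕ)) (λ LC → Σ (List (Vec (Vec Bool (n ∸ 1)) d)) (λ LB →
      Unique LC × (∀ μ → (μ ∈ LC) ⇔ InC n d μ) ×
      Unique LB × (∀ I → (I ∈ LB) ⇔ IsNice I) ×
      sumℚ (map (λ μ → powℚ (fromℕ (size μ)) k) LC)
        ≡ sumℚ (map (λ I → powℚ (summand n I) k) LB)))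
lemma3p2 (suc N) d k _ d≥1 _ =
  map partition niceMatrices , niceMatrices ,
  Unique.map⁺ partition-injective niceMatrices-unique , ∈partitions⇔ d≥1 ,
  niceMatrices-unique , ∈niceMatrices⇔ ,
  cong sumℚ (begin
    map (λ μ → powℚ (fromℕ (size μ)) k) (map partition niceMatrices)
      ≡⟨ sym (List.map-∘ niceMatrices) ⟩
    map (λ I → powℚ (fromℕ (size (partition I))) k) niceMatrices
      ≡⟨ List.map-cong (λ I → cong (λ q → powℚ q k) (sym (summand≡size I))) niceMatrices ⟩
    map (λ I → powℚ (summand (suc N) I) k) niceMatrices ∎)
  where
  open Matrices N d
  open ≡-Reasoning
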